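{- For every string $x\in\{0,1\}^*$, the graph $G_x$ defined below is a bipartite grid layered planar graph. Moreover, each connected component of $G_x$ is either a single edge or a path that extends from the first block to the last block of $G_x$.
   Context: A grid layered planar graph is a planar graph embedded in the integer lattice $\mathbb{Z}^2$ (vertices are lattice points $(a,b)$, $a$ the column and $b$ the row) such that every edge joins points $(a,b),(c,d)$ with $|a-c|\le 1$. Construction of $G_x$. For $x=x_1\cdots x_n$ let $f(x)=0\,\mathrm{bd}(0x_10x_20\cdots0x_n0)\,0$, where $\mathrm{bd}(y_1\cdots y_k)=y_1y_1\cdots y_ky_k$. Write $f(x)=y_1\cdots y_m$ ($m$ even) and split it into constituent pairs $P_k=y_{2k-1}y_{2k}$, $k=1,\dots,m/2$; each $P_k\in\{00,01,10\}$. Three blocks are defined, each drawn in a $2\times 6$ piece of lattice with local columns $0,1$ and rows $0,\dots,5$: - $G_{00}$: vertices $(0,0),(1,0),(0,5),(1,5),(0,2),(0,3)$; edges $(0,0)(1,0)$, $(0,5)(1,5)$, $(0,2)(0,3)$. - $G_{01}$: vertices $(0,1),(1,1),(0,4),(1,4),(1,2),(1,3)$; edges $(0,1)(1,1)$, $(0,4)(1,4)$, $(1,2)(1,3)$. - $G_{10}$: vertices $(0,0),(1,0),(0,5),(1,5),(0,1),(0,4)$; edges $(0,0)(1,0)$, $(0,0)(0,1)$, $(0,5)(1,5)$, $(0,5)(0,4)$. $G_x=G_{P_1}\odot G_{P_2}\odot\cdots\odot G_{P_{m/2}}$ is obtained by placing a copy of block $G_{P_k}$ in global columns $2k-2,2k-1$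 (rows $0$–$5$, shifting the local column by $2k-2$), and for each $k<m/2$ adding two connecting edges: from $(2k-1,a_k)$ to $(2k,b_{k+1})$ and from $(2k-1,5-a_k)$ to $(2k,5-b_{k+1})$, where $a_k=1$ if $P_k=01$ and $a_k=0$ otherwise, and $b_{k+1}=1$ if $P_{k+1}\in\{01,10\}$ and $b_{k+1}=0$ if $P_{k+1}=00$. The $k$-th block of $G_x$ is the copy of $G_{P_k}$. -}

module Defs where

open import Data.Bool using (Bool; true; false)
open import Data.Nat using (ℕ; zero; suc; _+_; _*_; _∸_; _≤_; _<_)
open import Data.Integer as ℤ using (ℤ; +_)
open import Data.List using (List; []; _∷_; _++_; map; concatMap; length; zip; drop; _∷ʳ_)
open import Data.List.Membership.Propositional using (_∈_)
open import Data.List.Relation.Unary.Unique.Propositional using (Unique)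
open import Data.Product using (_×_; _,_; proj₁; proj₂; Σ; ∃; ∃-syntax)
open import Data.Sum using (_⊎_)
open import Relation.Binary.PropositionalEquality using (_≡_; _≢_)
open import Relation.Nullary using (¬_)
open import Function.Bundles using (_⇔_)

-- A lattice point (a , b): a = column, b = row.  All points of G_x have
-- nonnegative coordinates, so ℕ × ℕ suffices.
Point : Set
Point = ℕ × ℕ

col : Point → ℕ
col = proj₁

record Graph : Set where
  constructor mkGraph
  field
    V : List Point
    E : List (Point × Point)
open Graph public

bd : List Bool → List Bool
bd []       = []
bd (y ∷ ys) = y ∷ y ∷ bd ys

interleave0 : List Bool → List Bool
interleave0 []       = false ∷ []
interleave0 (b ∷ bs) = false ∷ b ∷ interleave0 bs

f : List Bool → List Bool
f x = false ∷ (bd (interleave0 x) ∷ʳ false)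

pairs : List Bool → List (Bool × Bool)
pairs (a ∷ b ∷ ys) = (a , b) ∷ pairs ys
pairs _            = []

P : List Bool → List (Bool × Bool)
P x = pairs (f x)

-- blocks G₀₀, G₀₁, G₁₀ (local columns 0,1; rows 0..5).
-- The pair 11 never occurs in f(x); it is given the empty block.
blockV : Bool × Bool → List Point
blockV (false , false) = (0 , 0) ∷ (1 , 0) ∷ (0 , 5) ∷ (1 , 5) ∷ (0 , 2) ∷ (0 , 3) ∷ []
blockV (false , true)  = (0 , 1) ∷ (1 , 1) ∷ (0 , 4) ∷ (1 , 4) ∷ (1 , 2) ∷ (1 , 3) ∷ []
blockV (true  , false) = (0 , 0) ∷ (1 , 0) ∷ (0 , 5) ∷ (1 , 5) ∷ (0 , 1) ∷ (0 , 4) ∷ []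
blockV (true  , true)  = []

blockE : Bool × Bool → List (Point × Point)
blockE (false , false) = ((0 , 0) , (1 , 0)) ∷ ((0 , 5) , (1 , 5)) ∷ ((0 , 2) , (0 , 3)) ∷ []
blockE (false , true)  = ((0 , 1) , (1 , 1)) ∷ ((0 , 4) , (1 , 4)) ∷ ((1 , 2) , (1 , 3)) ∷ []
blockE (true  , false) = ((0 , 0) , (1 , 0)) ∷ ((0 , 0) , (0 , 1)) ∷ ((0 , 5) , (1 , 5)) ∷ ((0 , 5) , (0 , 4)) ∷ []
blockE (true  , true)  = []

aOf : Bool × Bool → ℕ
aOf (false , true) = 1
aOf _              = 0

bOf : Bool × Bool → ℕ
bOf (false , false) = 0
bOf _               = 1

shift : ℕ → Point → Point
shift c (a , b) = (c + a , b)

shiftE : ℕ → Point × Point → Point × Point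
shiftE c (p , q) = (shift c p , shift c q)

-- blocks numbered from 0: block number k (= the (k+1)-th block of the
-- paper) occupies global columns 2k, 2k+1.
enum : {A : Set} → ℕ → List A → List (ℕ × A)
enum k []       = []
enum k (a ∷ as) = (k , a) ∷ enum (suc k) as

blockVs : List (ℕ × (Bool × Bool)) → List Point
blockVs = concatMap (λ kp → map (shift (2 * proj₁ kp)) (blockV (proj₂ kp)))

blockEs : List (ℕ × (Bool × Bool)) → List (Point × Point)
blockEs = concatMap (λ kp → map (shiftE (2 * proj₁ kp)) (blockE (proj₂ kp)))

connect : ℕ → Bool × Bool → Bool × Bool → List (Point × Point)
connect k Pk Pk1 =
  ((2 * k + 1 , aOf Pk) , (2 * k + 2 , bOf Pk1)) ∷
  ((2 * k + 1 , 5 ∸ aOf Pk) , (2 * k + 2 , 5 ∸ bOf Pk1)) ∷ []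

connectEs : List (Bool × Bool) → List (Point × Point)
connectEs ps =
  concatMap (λ q → connect (proj₁ (proj₁ q)) (proj₂ (proj₁ q)) (proj₂ q))
            (zip (enum 0 ps) (drop 1 ps))

Gx : List Bool → Graph
Gx x = mkGraph (blockVs (enum 0 (P x))) (blockEs (enum 0 (P x)) ++ connectEs (P x))

numBlocks : List Bool → ℕ
numBlocks x = length (P x)

InBlock : ℕ → Point → Set
InBlock k v = (col v ≡ 2 * k) ⊎ (col v ≡ 2 * k + 1)

Adj : Graph → Point → Point → Set
Adj G p q = ((p , q) ∈ E G) ⊎ ((q , p) ∈ E G)

data Reach (G : Graph) : Point → Point → Set where
  here : ∀ {v} → Reach G v v
  step : ∀ {u v w} → Adj G u v → Reach G v w → Reach G u w

Bipartite : Graph → Set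
Bipartite G = Σ (Point → Bool) λ c → ∀ p q → (p , q) ∈ E G → c p ≢ c q

ι : ℕ → ℤ
ι n = + n

-- the point  (1 - t/d)·p + (t/d)·q  of segment pq, scaled by d,
-- equals the point (1 - u/d)·r + (u/d)·s of segment rs, scaled by d
-- (d > 0, 0 ≤ t,u ≤ d: all rational parameters in [0,1] with a common
-- denominator).
SegMeet : ℕ → ℕ → ℕ → Point → Point → Point → Point → Set
SegMeet d t u p q r s =
  (ι d ℤ.* ι (proj₁ p) ℤ.+ ι t ℤ.* (ι (proj₁ q) ℤ.- ι (proj₁ p))
     ≡ ι d ℤ.* ι (proj₁ r) ℤ.+ ι u ℤ.* (ι (proj₁ s) ℤ.- ι (proj₁ r)))
  × (ι d ℤ.* ι (proj₂ p) ℤ.+ ι t ℤ.* (ι (proj₂ q) ℤ.- ι (proj₂ p))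
     ≡ ι d ℤ.* ι (proj₂ r) ℤ.+ ι u ℤ.* (ι (proj₂ s) ℤ.- ι (proj₂ r)))

IsEndParam : ℕ → ℕ → Set
IsEndParam d t = (t ≡ 0) ⊎ (t ≡ d)

SameEdge : Point × Point → Point × Point → Set
SameEdge (p , q) (r , s) = ((p ≡ r) × (q ≡ s)) ⊎ ((p ≡ s) × (q ≡ r))

IsGridLayeredPlanar : Graph → Set
IsGridLayeredPlanar G =
  Unique (V G)
  × (∀ p q → (p , q) ∈ E G → (p ∈ V G) × (q ∈ V G) × (p ≢ q))
  × (∀ p q → (p , q) ∈ E G → (col p ≤ suc (col q)) × (col q ≤ suc (col p)))
  × (∀ p q r s → (p , q) ∈ E G → (r , s) ∈ E G → ¬ SameEdge (p , q) (r , s) →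
       ∀ d t u → 0 < d → t ≤ d → u ≤ d → SegMeet d t u p q r s →
       IsEndParam d t × IsEndParam d u)
  × (∀ v p q → v ∈ V G → (p , q) ∈ E G →
       ∀ d t → 0 < d → t ≤ d → SegMeet d t 0 p q v v →
       IsEndParam d t)

ComponentIsPath : Graph → Point → (Point → Point → List Point → Set) → Set
ComponentIsPath G v Shape =
  ∃[ a ] ∃[ b ] ∃[ mid ]
    let ps = a ∷ (mid ∷ʳ b) in
    Unique ps
    × (∀ w → Reach G v w ⇔ (w ∈ ps))
    × (∀ xs y z ys → ps ≡ xs ++ y ∷ z ∷ ys → Adj G y z)
    × (∀ p q → (p , q) ∈ E G → Reach G v p →
         ∃[ xs ] ∃[ ys ] ((ps ≡ xs ++ p ∷ q ∷ ys) ⊎ (ps ≡ xs ++ q ∷ p ∷ ys)))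
    × Shape a b mid

module Submission where

-- The pair sequence P x is computed in closed form: its pairs are 00, 01, 10,
-- and 01 is never followed by 00 (WellFormed).  Everything else is proved for
-- an arbitrary well-formed sequence, with the edge list rearranged block by
-- block.
-- Planarity: the rows form three bands {0,1}, {2,3}, {4,5} and every edge is
-- a segment of one of four kinds inside a band.  A point of a segment scaled
-- by d has natural coordinates c·d + w with 0 ≤ w ≤ d; comparing such digit
-- expansions shows that different segments meet only at common endpoints.
-- Components and colouring: every vertex lies on the top path (rows 0,1),
-- the bottom path (rows 4,5) or a middle edge (rows 2,3).  A general lemma
-- (PathCover) turns such a cover by repetition-free paths into the component
-- description and a 2-colouring by the parity of positions along the paths.

open import Defs
open import Data.Bool using (Bool; true; false; not)
open import Data.Nat as ℕ using (ℕ; zero; suc; _+_; _*_; _∸_; _≤_; _<_; z≤n; s≤s)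
import Data.Nat.Properties as ℕP
import Data.Nat.Tactic.RingSolver as ℕSolver
import Data.Integer as ℤ
import Data.Integer.Properties as ℤP
import Data.Integer.Tactic.RingSolver as ℤSolver
open import Data.Maybe using (just)
open import Data.Maybe.Relation.Binary.Connected using (Connected; just)
open import Data.List using (List; []; _∷_; _++_; map; concatMap; zip; drop; length; _∷ʳ_; head; last)
open import Data.List.Properties using (++-assoc; map-++; ++-identityʳ)
open import Data.List.Membership.Propositional using (_∈_)
open import Data.List.Membership.Propositional.Properties using (∈-++⁺ˡ; ∈-++⁺ʳ; ∈-++⁻; ∈-map⁻; ∈-map⁺)
open import Data.List.Relation.Unary.Any using (here; there)
open import Data.List.Relation.Unary.All as All using (All; []; _∷_)
open import Data.List.Relation.Unary.AllPairs using ([]; _∷_)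
open import Data.List.Relation.Unary.Linked as Linked using (Linked; []; [-]; _∷_)
import Data.List.Relation.Unary.Linked.Properties as Linked
open import Data.List.Relation.Unary.Unique.Propositional using (Unique)
import Data.List.Relation.Unary.Unique.Propositional.Properties as Unique
open import Data.List.Relation.Binary.Subset.Propositional using (_⊆_)
open import Data.List.Relation.Binary.Permutation.Propositional using (_↭_; ↭-refl; ↭-trans; ↭-sym; ↭-reflexive)
open import Data.List.Relation.Binary.Permutation.Propositional.Properties using (∈-resp-↭; shifts; ++⁺ˡ)
open import Data.Product using (_×_; _,_; proj₁; proj₂; Σ; ∃-syntax)
open import Data.Product.Properties using (≡-dec)
open import Data.Sum using (_⊎_; inj₁; inj₂)
open import Data.Empty using (⊥-elim)
open import Relation.Binary.PropositionalEquality
open import Relation.Nullary using (¬_; Dec; yes; no)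
open import Function.Bundles using (mk⇔)

Pair : Set
Pair = Bool × Bool

-- The constituent pairs of f(x) after a leading pair (b,0): each symbol c of
-- x contributes the pairs (0,c) and (c,0), and the string ends with (0,0).
tailSeq : List Bool → List Pair
tailSeq []       = (false , false) ∷ []
tailSeq (c ∷ cs) = (false , c) ∷ (c , false) ∷ tailSeq cs

pairs-bd : ∀ b l → pairs (b ∷ (bd (interleave0 l) ∷ʳ false)) ≡ (b , false) ∷ tailSeq l
pairs-bd b []       = refl
pairs-bd b (c ∷ cs) = cong ((b , false) ∷_) (cong ((false , c) ∷_) (pairs-bd c cs))

data Admissible : Pair → Set where
  adm00 : Admissible (false , false)
  adm01 : Admissible (false , true)
  adm10 : Admissible (true , false)

-- A connection leaving block p on the inner row (a_p = 1) enters the next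
-- block p' on the inner row (b_p' = 1): the pair 01 is never followed by 00.
Compatible : Pair → Pair → Set
Compatible p p' = aOf p ≡ 1 → bOf p' ≡ 1

data WellFormed : List Pair → Set where
  single : ∀ {p} → Admissible p → WellFormed (p ∷ [])
  _∷⟨_⟩_ : ∀ {p p' ps} → Admissible p → Compatible p p' → WellFormed (p' ∷ ps) →
           WellFormed (p ∷ p' ∷ ps)

leading : ∀ b → Admissible (b , false)
leading false = adm00
leading true  = adm10

trailing : ∀ c → Admissible (false , c)
trailing false = adm00
trailing true  = adm01

leaves-outer : ∀ b {p'} → Compatible (b , false) p'
leaves-outer false ()
leaves-outer true  ()

trailing-compatible : ∀ c → Compatible (false , c) (c , false)
trailing-compatible false ()
trailing-compatible true  _ = refl

tailSeq-wellFormed : ∀ b l → WellFormed ((b , false) ∷ tailSeq l)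
tailSeq-wellFormed b []       = leading b ∷⟨ leaves-outer b ⟩ single adm00
tailSeq-wellFormed b (c ∷ cs) =
  leading b ∷⟨ leaves-outer b ⟩ (trailing c ∷⟨ trailing-compatible c ⟩ tailSeq-wellFormed c cs)

P-wellFormed : ∀ x → WellFormed (P x)
P-wellFormed x rewrite pairs-bd false x = tailSeq-wellFormed false x

connectNext : ℕ → Pair → List Pair → List (Point × Point)
connectNext k p []       = []
connectNext k p (p' ∷ _) = connect k p p'

connectEsFrom : ℕ → List Pair → List (Point × Point)
connectEsFrom k ps =
  concatMap (λ q → connect (proj₁ (proj₁ q)) (proj₂ (proj₁ q)) (proj₂ q)) (zip (enum k ps) (drop 1 ps))

connectEsFrom-∷ : ∀ k p ps → connectEsFrom k (p ∷ ps) ≡ connectNext k p ps ++ connectEsFrom (suc k) ps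
connectEsFrom-∷ k p []       = refl
connectEsFrom-∷ k p (p' ∷ ps) = refl

edgesFrom : ℕ → List Pair → List (Point × Point)
edgesFrom k []       = []
edgesFrom k (p ∷ ps) = map (shiftE (2 * k)) (blockE p) ++ (connectNext k p ps ++ edgesFrom (suc k) ps)

edgesFrom-↭ : ∀ k ps → blockEs (enum k ps) ++ connectEsFrom k ps ↭ edgesFrom k ps
edgesFrom-↭ k []       = ↭-refl
edgesFrom-↭ k (p ∷ ps) rewrite connectEsFrom-∷ k p ps =
  ↭-trans (↭-reflexive (++-assoc block later (connectNext k p ps ++ connectEsFrom (suc k) ps)))
          (++⁺ˡ block (↭-trans (shifts later (connectNext k p ps))
                               (++⁺ˡ (connectNext k p ps) (edgesFrom-↭ (suc k) ps))))
  where
  block later : List (Point × Point)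
  block = map (shiftE (2 * k)) (blockE p)
  later = blockEs (enum (suc k) ps)

-- Segments and their scaled points

-- Rows come in three bands.  Level 0 of a band is its outer row (0, 2, 5),
-- level 1 its inner row (1, 3, 4).
data Band : Set where
  upper middle lower : Band

row : Band → ℕ → ℕ
row upper  ℓ = ℓ
row middle ℓ = 2 + ℓ
row lower  ℓ = 5 ∸ ℓ

-- The segment kinds inside a band: horizontal on the outer level, slanted
-- from the outer to the inner level, horizontal on the inner level, and
-- vertical (a rung) from the outer to the inner level.
data Kind : Set where
  outer slant inner rung : Kind

startLevel endLevel width : Kind → ℕ
startLevel outer = 0
startLevel slant = 0
startLevel inner = 1
startLevel rung  = 0
endLevel outer = 0
endLevel slant = 1
endLevel inner = 1
endLevel rung  = 1
width outer = 1
width slant = 1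
width inner = 1
width rung  = 0

Shape : Set
Shape = Band × Kind

segment : Shape → ℕ → Point × Point
segment (b , k) c = (c , row b (startLevel k)) , (c + width k , row b (endLevel k))

-- The point at parameter t/d of a segment, scaled by d, has column
-- c·d + xOffset and row base·d + (offset inside the band); both offsets lie
-- in [0, d].
xOffset : Kind → ℕ → ℕ
xOffset outer t = t
xOffset slant t = t
xOffset inner t = t
xOffset rung  t = 0

levelAt : Kind → ℕ → ℕ → ℕ
levelAt outer d t = 0
levelAt slant d t = t
levelAt inner d t = d
levelAt rung  d t = t

base : Band → ℕ
base upper  = 0
base middle = 2
base lower  = 4

-- the lower band is read upwards from its outer row 5
inBand : Band → ℕ → ℕ → ℕ
inBand upper  d v = v
inBand middle d v = v
inBand lower  d v = d ∸ v

xAt : Kind → ℕ → ℕ → ℕ → ℕ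
xAt k c d t = c * d + xOffset k t

yAt : Shape → ℕ → ℕ → ℕ
yAt (b , k) d t = base b * d + inBand b d (levelAt k d t)

xOffset≤ : ∀ k {d t} → t ≤ d → xOffset k t ≤ d
xOffset≤ outer t≤d = t≤d
xOffset≤ slant t≤d = t≤d
xOffset≤ inner t≤d = t≤d
xOffset≤ rung  t≤d = z≤n

levelAt≤ : ∀ k {d t} → t ≤ d → levelAt k d t ≤ d
levelAt≤ outer t≤d = z≤n
levelAt≤ slant t≤d = t≤d
levelAt≤ inner t≤d = ℕP.≤-refl
levelAt≤ rung  t≤d = t≤d

inBand≤ : ∀ b {d v} → v ≤ d → inBand b d v ≤ d
inBand≤ upper  v≤d = v≤d
inBand≤ middle v≤d = v≤d
inBand≤ lower  {d} {v} _ = ℕP.m∸n≤m d v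

-- Scaled coordinates in ℤ are natural numbers: the coordinate d·a + t·(b − a)
-- of the point at parameter t/d between a and b equals V as soon as the
-- identity a·d + b·t = V + a·t holds in ℕ.
lerp : ∀ d t a b V → a * d + b * t ≡ V + a * t → ι d ℤ.* ι a ℤ.+ ι t ℤ.* (ι b ℤ.- ι a) ≡ ι V
lerp d t a b V eq = begin
  ι d ℤ.* ι a ℤ.+ ι t ℤ.* (ι b ℤ.- ι a)         ≡⟨ expand (ι d) (ι t) (ι a) (ι b) ⟩
  (ι a ℤ.* ι d ℤ.+ ι b ℤ.* ι t) ℤ.- ι a ℤ.* ι t ≡⟨ cong (ℤ._- ι a ℤ.* ι t) (sym (ι-linear a d b t)) ⟩
  ι (a * d + b * t) ℤ.- ι a ℤ.* ι t             ≡⟨ cong (λ z → ι z ℤ.- ι a ℤ.* ι t) eq ⟩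
  ι (V + a * t) ℤ.- ι a ℤ.* ι t                 ≡⟨ cong (ℤ._- ι a ℤ.* ι t) (ℤP.pos-+ V (a * t)) ⟩
  (ι V ℤ.+ ι (a * t)) ℤ.- ι a ℤ.* ι t           ≡⟨ cong (λ z → (ι V ℤ.+ z) ℤ.- ι a ℤ.* ι t) (ℤP.pos-* a t) ⟩
  (ι V ℤ.+ ι a ℤ.* ι t) ℤ.- ι a ℤ.* ι t         ≡⟨ cancel (ι V) (ι a ℤ.* ι t) ⟩
  ι V                                           ∎
  where
  open ≡-Reasoning
  ι-linear : ∀ a b c e → ι (a * b + c * e) ≡ ι a ℤ.* ι b ℤ.+ ι c ℤ.* ι e
  ι-linear a b c e = trans (ℤP.pos-+ (a * b) (c * e)) (cong₂ ℤ._+_ (ℤP.pos-* a b) (ℤP.pos-* c e))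
  expand : ∀ D T A B → D ℤ.* A ℤ.+ T ℤ.* (B ℤ.- A) ≡ (A ℤ.* D ℤ.+ B ℤ.* T) ℤ.- A ℤ.* T
  expand = ℤSolver.solve-∀
  cancel : ∀ W X → (W ℤ.+ X) ℤ.- X ≡ W
  cancel = ℤSolver.solve-∀

horizontal-identity : ∀ c d t → c * d + (c + 1) * t ≡ (c * d + t) + c * t
horizontal-identity = ℕSolver.solve-∀

vertical-identity : ∀ c d t → c * d + (c + 0) * t ≡ (c * d + 0) + c * t
vertical-identity = ℕSolver.solve-∀

xAt-identity : ∀ k c d t → c * d + (c + width k) * t ≡ xAt k c d t + c * t
xAt-identity outer = horizontal-identity
xAt-identity slant = horizontal-identity
xAt-identity inner = horizontal-identity
xAt-identity rung  = vertical-identity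

ascending : ∀ β k d t →
  (β + startLevel k) * d + (β + endLevel k) * t ≡ (β * d + levelAt k d t) + (β + startLevel k) * t
ascending β outer = flat β
  where flat : ∀ β d t → (β + 0) * d + (β + 0) * t ≡ (β * d + 0) + (β + 0) * t
        flat = ℕSolver.solve-∀
ascending β slant = rising β
  where rising : ∀ β d t → (β + 0) * d + (β + 1) * t ≡ (β * d + t) + (β + 0) * t
        rising = ℕSolver.solve-∀
ascending β inner = flat β
  where flat : ∀ β d t → (β + 1) * d + (β + 1) * t ≡ (β * d + d) + (β + 1) * t
        flat = ℕSolver.solve-∀
ascending β rung  = rising β
  where rising : ∀ β d t → (β + 0) * d + (β + 1) * t ≡ (β * d + t) + (β + 0) * t
        rising = ℕSolver.solve-∀

-- … and in the lower band, whose rows decrease from 5 to 4 (this needs t ≤ d)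
descent : ∀ d t → t ≤ d → 5 * d + 4 * t ≡ (4 * d + (d ∸ t)) + 5 * t
descent d t t≤d = begin
  5 * d + 4 * t                 ≡⟨ split d t ⟩
  4 * d + d + 4 * t             ≡⟨ cong (λ z → 4 * d + z + 4 * t) (sym (ℕP.m∸n+n≡m t≤d)) ⟩
  4 * d + ((d ∸ t) + t) + 4 * t ≡⟨ regroup (4 * d) (d ∸ t) t ⟩
  (4 * d + (d ∸ t)) + 5 * t     ∎
  where
  open ≡-Reasoning
  split : ∀ d t → 5 * d + 4 * t ≡ 4 * d + d + 4 * t
  split = ℕSolver.solve-∀
  regroup : ∀ X R T → X + (R + T) + 4 * T ≡ (X + R) + 5 * T
  regroup = ℕSolver.solve-∀

descending : ∀ k d t → t ≤ d →
  row lower (startLevel k) * d + row lower (endLevel k) * t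
    ≡ (4 * d + (d ∸ levelAt k d t)) + row lower (startLevel k) * t
descending outer d t _   = flat d t
  where flat : ∀ d t → 5 * d + 5 * t ≡ (4 * d + d) + 5 * t
        flat = ℕSolver.solve-∀
descending slant d t t≤d = descent d t t≤d
descending inner d t _   rewrite ℕP.n∸n≡0 d = flat d t
  where flat : ∀ d t → 4 * d + 4 * t ≡ (4 * d + 0) + 4 * t
        flat = ℕSolver.solve-∀
descending rung  d t t≤d = descent d t t≤d

yAt-identity : ∀ b k d t → t ≤ d →
  row b (startLevel k) * d + row b (endLevel k) * t ≡ yAt (b , k) d t + row b (startLevel k) * t
yAt-identity upper  k d t _   = ascending 0 k d t
yAt-identity middle k d t _   = ascending 2 k d t
yAt-identity lower  k d t t≤d = descending k d t t≤d

segments-meet : ∀ b₁ k₁ c₁ b₂ k₂ c₂ d t u → t ≤ d → u ≤ d →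
  SegMeet d t u (proj₁ (segment (b₁ , k₁) c₁)) (proj₂ (segment (b₁ , k₁) c₁))
                (proj₁ (segment (b₂ , k₂) c₂)) (proj₂ (segment (b₂ , k₂) c₂)) →
  xAt k₁ c₁ d t ≡ xAt k₂ c₂ d u × yAt (b₁ , k₁) d t ≡ yAt (b₂ , k₂) d u
segments-meet b₁ k₁ c₁ b₂ k₂ c₂ d t u t≤d u≤d (x-meet , y-meet) =
  ℤP.+-injective (trans (sym (lerp d t _ _ _ (xAt-identity k₁ c₁ d t)))
                        (trans x-meet (lerp d u _ _ _ (xAt-identity k₂ c₂ d u)))) ,
  ℤP.+-injective (trans (sym (lerp d t _ _ _ (yAt-identity b₁ k₁ d t t≤d)))
                        (trans y-meet (lerp d u _ _ _ (yAt-identity b₂ k₂ d u u≤d))))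

vertex-meets : ∀ b k c v d t → t ≤ d →
  SegMeet d t 0 (proj₁ (segment (b , k) c)) (proj₂ (segment (b , k) c)) v v →
  xAt k c d t ≡ proj₁ v * d × yAt (b , k) d t ≡ proj₂ v * d
vertex-meets b k c (cv , rv) d t t≤d (x-meet , y-meet) =
  ℤP.+-injective (trans (sym (lerp d t _ _ _ (xAt-identity k c d t))) (trans x-meet (lerp d 0 cv cv _ refl))) ,
  ℤP.+-injective (trans (sym (lerp d t _ _ _ (yAt-identity b k d t t≤d))) (trans y-meet (lerp d 0 rv rv _ refl)))

carry : ∀ c {d w w'} → 0 < d → w ≤ d → w ≡ suc c * d + w' → suc c ≡ 1 × w ≡ d × w' ≡ 0
carry c {suc d'} {w} {w'} _ w≤d eq = cong suc c≡0 , trans eq' (trans (cong (d +_) rest≡0) (ℕP.+-identityʳ d)) , w'≡0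
  where
  d : ℕ
  d = suc d'
  eq' : w ≡ d + (c * d + w')
  eq' = trans eq (ℕP.+-assoc d (c * d) w')
  rest≡0 : c * d + w' ≡ 0
  rest≡0 = ℕP.n≤0⇒n≡0 (ℕP.+-cancelˡ-≤ d _ 0 (subst (_≤ d + 0) eq' (subst (w ≤_) (sym (ℕP.+-identityʳ d)) w≤d)))
  c≡0 : c ≡ 0
  c≡0 = ℕP.m*n≡0⇒m≡0 c d (ℕP.m+n≡0⇒m≡0 (c * d) rest≡0)
  w'≡0 : w' ≡ 0
  w'≡0 = ℕP.m+n≡0⇒n≡0 (c * d) rest≡0

digits : ∀ c₁ c₂ {d w₁ w₂} → 0 < d → w₁ ≤ d → w₂ ≤ d → c₁ * d + w₁ ≡ c₂ * d + w₂ →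
  (c₁ ≡ c₂ × w₁ ≡ w₂) ⊎ (c₂ ≡ suc c₁ × w₁ ≡ d × w₂ ≡ 0) ⊎ (c₁ ≡ suc c₂ × w₁ ≡ 0 × w₂ ≡ d)
digits zero     zero     _   _   _   eq = inj₁ (refl , eq)
digits zero     (suc c₂) d>0 w₁≤ _   eq = inj₂ (inj₁ (carry c₂ d>0 w₁≤ eq))
digits (suc c₁) zero     d>0 _   w₂≤ eq with carry c₁ d>0 w₂≤ (sym eq)
... | c , w₂≡d , w₁≡0 = inj₂ (inj₂ (c , w₁≡0 , w₂≡d))
digits (suc c₁) (suc c₂) {d} {w₁} {w₂} d>0 w₁≤ w₂≤ eq with digits c₁ c₂ d>0 w₁≤ w₂≤ drop-d
  where
  drop-d : c₁ * d + w₁ ≡ c₂ * d + w₂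
  drop-d = ℕP.+-cancelˡ-≡ d _ _ (trans (sym (ℕP.+-assoc d (c₁ * d) w₁)) (trans eq (ℕP.+-assoc d (c₂ * d) w₂)))
... | inj₁ (c , w)         = inj₁ (cong suc c , w)
... | inj₂ (inj₁ (c , w))  = inj₂ (inj₁ (cong suc c , w))
... | inj₂ (inj₂ (c , w))  = inj₂ (inj₂ (cong suc c , w))

viaColumns : ∀ {c₁ c₂ d t u : ℕ} → (c₁ ≡ c₂ × t ≡ u) ⊎ (IsEndParam d t × IsEndParam d u) →
  (c₁ ≡ c₂ → t ≡ u → IsEndParam d t × IsEndParam d u) → IsEndParam d t × IsEndParam d u
viaColumns (inj₁ (c , t≡u)) same = same c t≡u
viaColumns (inj₂ ends)      _    = ends

sameColumnOrEnds : ∀ c₁ c₂ {d w₁ w₂} → 0 < d → w₁ ≤ d → w₂ ≤ d → c₁ * d + w₁ ≡ c₂ * d + w₂ →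
  (c₁ ≡ c₂ × w₁ ≡ w₂) ⊎ (IsEndParam d w₁ × IsEndParam d w₂)
sameColumnOrEnds c₁ c₂ d>0 w₁≤ w₂≤ eq with digits c₁ c₂ d>0 w₁≤ w₂≤ eq
... | inj₁ same                     = inj₁ same
... | inj₂ (inj₁ (_ , w₁≡d , w₂≡0)) = inj₂ (inj₂ w₁≡d , inj₁ w₂≡0)
... | inj₂ (inj₂ (_ , w₁≡0 , w₂≡d)) = inj₂ (inj₁ w₁≡0 , inj₂ w₂≡d)

multipleEnds : ∀ c₁ c₂ {d w} → 0 < d → w ≤ d → c₁ * d + w ≡ c₂ * d + 0 → IsEndParam d w
multipleEnds c₁ c₂ d>0 w≤d eq with sameColumnOrEnds c₁ c₂ d>0 w≤d z≤n eq
... | inj₁ (_ , w≡0) = inj₁ w≡0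
... | inj₂ (e , _)   = e

sameColumn : ∀ c₁ c₂ {d} → 0 < d → c₁ * d + 0 ≡ c₂ * d + 0 → c₁ ≡ c₂
sameColumn c₁ c₂ {suc d} _ eq =
  ℕP.*-cancelʳ-≡ c₁ c₂ (suc d) (trans (sym (ℕP.+-identityʳ _)) (trans eq (ℕP.+-identityʳ _)))

nonzero : ∀ {d} → 0 < d → 0 ≢ d
nonzero (s≤s _) ()

base-injective : ∀ b₁ b₂ → base b₁ ≡ base b₂ → b₁ ≡ b₂
base-injective upper  upper  _  = refl
base-injective upper  middle ()
base-injective upper  lower  ()
base-injective middle upper  ()
base-injective middle middle _  = refl
base-injective middle lower  ()
base-injective lower  upper  ()
base-injective lower  middle ()
base-injective lower  lower  _  = refl

no-carry : ∀ b₁ b₂ → base b₂ ≢ suc (base b₁)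
no-carry upper  upper  ()
no-carry upper  middle ()
no-carry upper  lower  ()
no-carry middle upper  ()
no-carry middle middle ()
no-carry middle lower  ()
no-carry lower  upper  ()
no-carry lower  middle ()
no-carry lower  lower  ()

inBand-injective : ∀ {b₁ b₂ d v₁ v₂} → b₁ ≡ b₂ → v₁ ≤ d → v₂ ≤ d →
  inBand b₁ d v₁ ≡ inBand b₂ d v₂ → v₁ ≡ v₂
inBand-injective {upper}  refl _   _   eq = eq
inBand-injective {middle} refl _   _   eq = eq
inBand-injective {lower}  refl v₁≤ v₂≤ eq = ℕP.∸-cancelˡ-≡ v₁≤ v₂≤ eq

inBand-ends : ∀ b {d v} → v ≤ d → IsEndParam d (inBand b d v) → IsEndParam d v
inBand-ends upper  _   e = e
inBand-ends middle _   e = e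
inBand-ends lower  {d} {v} v≤d (inj₁ d∸v≡0) =
  inj₂ (trans (sym (ℕP.+-identityˡ v)) (trans (cong (_+ v) (sym d∸v≡0)) (ℕP.m∸n+n≡m v≤d)))
inBand-ends lower  {d} {v} v≤d (inj₂ d∸v≡d) =
  inj₁ (ℕP.+-cancelˡ-≡ d v 0 (trans (cong (_+ v) (sym d∸v≡d)) (trans (ℕP.m∸n+n≡m v≤d) (sym (ℕP.+-identityʳ d)))))

sameBand : ∀ b₁ b₂ {d v₁ v₂} → 0 < d → v₁ ≤ d → v₂ ≤ d →
  base b₁ * d + inBand b₁ d v₁ ≡ base b₂ * d + inBand b₂ d v₂ → b₁ ≡ b₂ × v₁ ≡ v₂
sameBand b₁ b₂ d>0 v₁≤ v₂≤ eq with digits (base b₁) (base b₂) d>0 (inBand≤ b₁ v₁≤) (inBand≤ b₂ v₂≤) eq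
... | inj₁ (base≡ , w≡) = let b≡ = base-injective b₁ b₂ base≡ in b≡ , inBand-injective b≡ v₁≤ v₂≤ w≡
... | inj₂ (inj₁ (c , _)) = ⊥-elim (no-carry b₁ b₂ c)
... | inj₂ (inj₂ (c , _)) = ⊥-elim (no-carry b₂ b₁ c)

kindMeet : ∀ k₁ k₂ c₁ c₂ {d t u} → 0 < d → t ≤ d → u ≤ d →
  xAt k₁ c₁ d t ≡ xAt k₂ c₂ d u → levelAt k₁ d t ≡ levelAt k₂ d u →
  ¬ (k₁ ≡ k₂ × c₁ ≡ c₂) → IsEndParam d t × IsEndParam d u
kindMeet outer outer c₁ c₂ d>0 t≤ u≤ x l ne = viaColumns (sameColumnOrEnds c₁ c₂ d>0 t≤ u≤ x) λ c _ → ⊥-elim (ne (refl , c))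
kindMeet outer slant c₁ c₂ d>0 t≤ u≤ x l ne = viaColumns (sameColumnOrEnds c₁ c₂ d>0 t≤ u≤ x) λ _ t≡u → inj₁ (trans t≡u (sym l)) , inj₁ (sym l)
kindMeet outer inner c₁ c₂ d>0 t≤ u≤ x l ne = ⊥-elim (nonzero d>0 l)
kindMeet outer rung  c₁ c₂ d>0 t≤ u≤ x l ne = multipleEnds c₁ c₂ d>0 t≤ x , inj₁ (sym l)
kindMeet slant outer c₁ c₂ d>0 t≤ u≤ x l ne = viaColumns (sameColumnOrEnds c₁ c₂ d>0 t≤ u≤ x) λ _ t≡u → inj₁ l , inj₁ (trans (sym t≡u) l)
kindMeet slant slant c₁ c₂ d>0 t≤ u≤ x l ne = viaColumns (sameColumnOrEnds c₁ c₂ d>0 t≤ u≤ x) λ c _ → ⊥-elim (ne (refl , c))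
kindMeet slant inner c₁ c₂ d>0 t≤ u≤ x l ne = viaColumns (sameColumnOrEnds c₁ c₂ d>0 t≤ u≤ x) λ _ t≡u → inj₂ l , inj₂ (trans (sym t≡u) l)
kindMeet slant rung  c₁ c₂ d>0 t≤ u≤ x l ne = let e = multipleEnds c₁ c₂ d>0 t≤ x in e , subst (IsEndParam _) l e
kindMeet inner outer c₁ c₂ d>0 t≤ u≤ x l ne = ⊥-elim (nonzero d>0 (sym l))
kindMeet inner slant c₁ c₂ d>0 t≤ u≤ x l ne = viaColumns (sameColumnOrEnds c₁ c₂ d>0 t≤ u≤ x) λ _ t≡u → inj₂ (trans t≡u (sym l)) , inj₂ (sym l)
kindMeet inner inner c₁ c₂ d>0 t≤ u≤ x l ne = viaColumns (sameColumnOrEnds c₁ c₂ d>0 t≤ u≤ x) λ c _ → ⊥-elim (ne (refl , c))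
kindMeet inner rung  c₁ c₂ d>0 t≤ u≤ x l ne = multipleEnds c₁ c₂ d>0 t≤ x , inj₂ (sym l)
kindMeet rung  outer c₁ c₂ d>0 t≤ u≤ x l ne = inj₁ l , multipleEnds c₂ c₁ d>0 u≤ (sym x)
kindMeet rung  slant c₁ c₂ d>0 t≤ u≤ x l ne = let e = multipleEnds c₂ c₁ d>0 u≤ (sym x) in subst (IsEndParam _) (sym l) e , e
kindMeet rung  inner c₁ c₂ d>0 t≤ u≤ x l ne = inj₂ l , multipleEnds c₂ c₁ d>0 u≤ (sym x)
kindMeet rung  rung  c₁ c₂ d>0 t≤ u≤ x l ne = ⊥-elim (ne (refl , sameColumn c₁ c₂ d>0 x))

segments-meet-at-ends : ∀ s₁ c₁ s₂ c₂ → ¬ SameEdge (segment s₁ c₁) (segment s₂ c₂) →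
  ∀ d t u → 0 < d → t ≤ d → u ≤ d →
  SegMeet d t u (proj₁ (segment s₁ c₁)) (proj₂ (segment s₁ c₁)) (proj₁ (segment s₂ c₂)) (proj₂ (segment s₂ c₂)) →
  IsEndParam d t × IsEndParam d u
segments-meet-at-ends (b₁ , k₁) c₁ (b₂ , k₂) c₂ ne d t u d>0 t≤ u≤ meet
  with segments-meet b₁ k₁ c₁ b₂ k₂ c₂ d t u t≤ u≤ meet
... | x≡ , y≡ with sameBand b₁ b₂ d>0 (levelAt≤ k₁ t≤) (levelAt≤ k₂ u≤) y≡
...   | refl , level≡ = kindMeet k₁ k₂ c₁ c₂ d>0 t≤ u≤ x≡ level≡ same-segment
  where
  same-segment : ¬ (k₁ ≡ k₂ × c₁ ≡ c₂)
  same-segment (refl , refl) = ne (inj₁ (refl , refl))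

kind-ends : ∀ k {d t} → IsEndParam d (xOffset k t) → IsEndParam d (levelAt k d t) → IsEndParam d t
kind-ends outer x _ = x
kind-ends slant x _ = x
kind-ends inner x _ = x
kind-ends rung  _ l = l

vertex-at-end : ∀ s c v d t → 0 < d → t ≤ d →
  SegMeet d t 0 (proj₁ (segment s c)) (proj₂ (segment s c)) v v → IsEndParam d t
vertex-at-end (b , k) c (cv , rv) d t d>0 t≤ meet with vertex-meets b k c (cv , rv) d t t≤ meet
... | x≡ , y≡ =
  kind-ends k (multipleEnds c cv d>0 (xOffset≤ k t≤) (trans x≡ (sym (ℕP.+-identityʳ _))))
              (inBand-ends b (levelAt≤ k t≤)
                 (multipleEnds (base b) rv d>0 (inBand≤ b (levelAt≤ k t≤)) (trans y≡ (sym (ℕP.+-identityʳ _)))))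

Shaped : Point × Point → Set
Shaped e = Σ Shape λ s → Σ ℕ λ c → e ≡ segment s c

shaped : ∀ b k c {c'} → c' ≡ c + width k → Shaped ((c , row b (startLevel k)) , (c' , row b (endLevel k)))
shaped b k c refl = (b , k) , c , refl

right-column : ∀ c → c + 1 ≡ (c + 0) + 1
right-column c = cong (_+ 1) (sym (ℕP.+-identityʳ c))

same-column : ∀ c → c ≡ c + 0
same-column c = sym (ℕP.+-identityʳ c)

blockShaped : ∀ c p {e} → e ∈ map (shiftE c) (blockE p) → Shaped e
blockShaped c (false , false) (here refl)                         = shaped upper  outer (c + 0) (right-column c)
blockShaped c (false , false) (there (here refl))                 = shaped lower  outer (c + 0) (right-column c)
blockShaped c (false , false) (there (there (here refl)))         = shaped middle rung  (c + 0) (same-column (c + 0))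
blockShaped c (false , true)  (here refl)                         = shaped upper  inner (c + 0) (right-column c)
blockShaped c (false , true)  (there (here refl))                 = shaped lower  inner (c + 0) (right-column c)
blockShaped c (false , true)  (there (there (here refl)))         = shaped middle rung  (c + 1) (same-column (c + 1))
blockShaped c (true  , false) (here refl)                         = shaped upper  outer (c + 0) (right-column c)
blockShaped c (true  , false) (there (here refl))                 = shaped upper  rung  (c + 0) (same-column (c + 0))
blockShaped c (true  , false) (there (there (here refl)))         = shaped lower  outer (c + 0) (right-column c)
blockShaped c (true  , false) (there (there (there (here refl)))) = shaped lower  rung  (c + 0) (same-column (c + 0))

data Level : ℕ → Set where
  level0 : Level 0
  level1 : Level 1

aLevel : ∀ p → Level (aOf p)
aLevel (false , false) = level0
aLevel (false , true)  = level1
aLevel (true  , _)     = level0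

bLevel : ∀ p → Level (bOf p)
bLevel (false , false) = level0
bLevel (false , true)  = level1
bLevel (true  , _)     = level1

connectShaped : ∀ k {a b} → Level a → Level b → (a ≡ 1 → b ≡ 1) → ∀ {e} →
  e ∈ ((2 * k + 1 , a) , (2 * k + 2 , b)) ∷ ((2 * k + 1 , 5 ∸ a) , (2 * k + 2 , 5 ∸ b)) ∷ [] → Shaped e
connectShaped k level0 level0 _ (here refl)         = shaped upper outer (2 * k + 1) (sym (ℕP.+-assoc (2 * k) 1 1))
connectShaped k level0 level0 _ (there (here refl)) = shaped lower outer (2 * k + 1) (sym (ℕP.+-assoc (2 * k) 1 1))
connectShaped k level0 level1 _ (here refl)         = shaped upper slant (2 * k + 1) (sym (ℕP.+-assoc (2 * k) 1 1))
connectShaped k level0 level1 _ (there (here refl)) = shaped lower slant (2 * k + 1) (sym (ℕP.+-assoc (2 * k) 1 1))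
connectShaped k level1 level1 _ (here refl)         = shaped upper inner (2 * k + 1) (sym (ℕP.+-assoc (2 * k) 1 1))
connectShaped k level1 level1 _ (there (here refl)) = shaped lower inner (2 * k + 1) (sym (ℕP.+-assoc (2 * k) 1 1))
connectShaped k level1 level0 compatible _ with compatible refl
... | ()

edgeShaped : ∀ k ps → WellFormed ps → ∀ {e} → e ∈ edgesFrom k ps → Shaped e
edgeShaped k (p ∷ ps) wf m with ∈-++⁻ (map (shiftE (2 * k)) (blockE p)) m
... | inj₁ m₁ = blockShaped (2 * k) p m₁
edgeShaped k (p ∷ []) wf m | inj₂ ()
edgeShaped k (p ∷ p' ∷ ps) (_ ∷⟨ compatible ⟩ wf) m | inj₂ m₁ with ∈-++⁻ (connect k p p') m₁
... | inj₁ m₂ = connectShaped k (aLevel p) (bLevel p') compatible m₂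
... | inj₂ m₂ = edgeShaped (suc k) (p' ∷ ps) wf m₂

segment-distinct : ∀ s c → proj₁ (segment s c) ≢ proj₂ (segment s c)
segment-distinct (b      , outer) c eq = ℕP.m≢1+n+m c (trans (cong proj₁ eq) (ℕP.+-comm c 1))
segment-distinct (b      , slant) c eq = ℕP.m≢1+n+m c (trans (cong proj₁ eq) (ℕP.+-comm c 1))
segment-distinct (b      , inner) c eq = ℕP.m≢1+n+m c (trans (cong proj₁ eq) (ℕP.+-comm c 1))
segment-distinct (upper  , rung)  c ()
segment-distinct (middle , rung)  c ()
segment-distinct (lower  , rung)  c ()

segment-columns : ∀ (s : Shape) c → (c ≤ suc (c + width (proj₂ s))) × (c + width (proj₂ s) ≤ suc c)
segment-columns (b , k) c =
  ℕP.≤-trans (ℕP.m≤m+n c (width k)) (ℕP.n≤1+n _) ,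
  subst (c + width k ≤_) (ℕP.+-comm c 1) (ℕP.+-monoʳ-≤ c (width≤1 k))
  where
  width≤1 : ∀ k → width k ≤ 1
  width≤1 outer = s≤s z≤n
  width≤1 slant = s≤s z≤n
  width≤1 inner = s≤s z≤n
  width≤1 rung  = z≤n

Consecutive : List Point → Point → Point → Set
Consecutive L y z = ∃[ xs ] ∃[ ys ] (L ≡ xs ++ y ∷ z ∷ ys)

Neighbours : List Point → Point → Point → Set
Neighbours L y z = Consecutive L y z ⊎ Consecutive L z y

HasTwoEnds : List Point → Set
HasTwoEnds L = ∃[ a ] ∃[ mid ] ∃[ b ] (L ≡ a ∷ (mid ∷ʳ b))

neighbours-++ˡ : ∀ l {r y z} → Neighbours r y z → Neighbours (l ++ r) y z
neighbours-++ˡ l (inj₁ (xs , ys , refl)) = inj₁ (l ++ xs , ys , sym (++-assoc l xs _))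
neighbours-++ˡ l (inj₂ (xs , ys , refl)) = inj₂ (l ++ xs , ys , sym (++-assoc l xs _))

consecutive-∈ : ∀ {L y z} → Consecutive L y z → y ∈ L × z ∈ L
consecutive-∈ (xs , ys , refl) = ∈-++⁺ʳ xs (here refl) , ∈-++⁺ʳ xs (there (here refl))

neighbours-∈ : ∀ {L y z} → Neighbours L y z → y ∈ L × z ∈ L
neighbours-∈ (inj₁ c) = consecutive-∈ c
neighbours-∈ (inj₂ c) = let (z∈ , y∈) = consecutive-∈ c in y∈ , z∈

head-++ : ∀ xs ys {x : Point} → head xs ≡ just x → head (xs ++ ys) ≡ just x
head-++ (_ ∷ _) ys eq = eq

consecutive-junction : ∀ xs ys {y z} → last xs ≡ just y → head ys ≡ just z → Consecutive (xs ++ ys) y z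
consecutive-junction (x ∷ [])      (w ∷ ws) refl refl = [] , ws , refl
consecutive-junction (x ∷ x' ∷ xs) ys       l    h    =
  let (pre , post , eq) = consecutive-junction (x' ∷ xs) ys l h in x ∷ pre , post , cong (x ∷_) eq

linked-junction : ∀ {R : Point → Point → Set} xs ys {y z} → Linked R xs → Linked R ys →
  last xs ≡ just y → head ys ≡ just z → R y z → Linked R (xs ++ ys)
linked-junction {R} xs ys lxs lys l h r = Linked.++⁺ lxs (subst₂ (Connected R) (sym l) (sym h) (just r)) lys

linked-consecutive : ∀ {R : Point → Point → Set} xs {y z ys} → Linked R (xs ++ y ∷ z ∷ ys) → R y z
linked-consecutive []            (r ∷ _) = r
linked-consecutive (x ∷ [])      (_ ∷ l) = linked-consecutive [] l
linked-consecutive (x ∷ x' ∷ xs) (_ ∷ l) = linked-consecutive (x' ∷ xs) l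

blocksFrom : (Pair → List Point) → ℕ → List Pair → List Point
blocksFrom g k ps = concatMap (λ kp → map (shift (2 * proj₁ kp)) (g (proj₂ kp))) (enum k ps)

LocalColumns : (Pair → List Point) → Set
LocalColumns g = ∀ p → Admissible p → ∀ {v} → v ∈ g p → col v ≤ 1

blocksFrom-columns : ∀ g k ps {v} → v ∈ blocksFrom g k ps → 2 * k ≤ col v
blocksFrom-columns g k (p ∷ ps) m with ∈-++⁻ (map (shift (2 * k)) (g p)) m
... | inj₁ m₁ with ∈-map⁻ (shift (2 * k)) m₁
...   | w , _ , refl = ℕP.m≤m+n (2 * k) (proj₁ w)
blocksFrom-columns g k (p ∷ ps) m | inj₂ m₁ =
  ℕP.≤-trans (ℕP.*-monoʳ-≤ 2 (ℕP.n≤1+n k)) (blocksFrom-columns g (suc k) ps m₁)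

block-columns : ∀ g → LocalColumns g → ∀ c p → Admissible p → ∀ {v} → v ∈ map (shift c) (g p) → col v ≤ c + 1
block-columns g local c p a m with ∈-map⁻ (shift c) m
... | w , w∈ , refl = ℕP.+-monoʳ-≤ c (local p a w∈)

next-block : ∀ k → 2 * suc k ≡ 2 * k + 2
next-block = ℕSolver.solve-∀

-- Locally repetition-free lists give a repetition-free list, since distinct
-- blocks occupy distinct columns.
blocksFrom-unique : ∀ g → (∀ p → Admissible p → Unique (g p)) → LocalColumns g →
  ∀ k ps → All Admissible ps → Unique (blocksFrom g k ps)
blocksFrom-unique g unique local k []       _       = []
blocksFrom-unique g unique local k (p ∷ ps) (a ∷ as) =
  Unique.++⁺ (Unique.map⁺ shift-injective (unique p a)) (blocksFrom-unique g unique local (suc k) ps as) disjoint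
  where
  shift-injective : ∀ {v w} → shift (2 * k) v ≡ shift (2 * k) w → v ≡ w
  shift-injective {a , b} {a' , b'} eq = cong₂ _,_ (ℕP.+-cancelˡ-≡ (2 * k) a a' (cong proj₁ eq)) (cong proj₂ eq)
  disjoint : ∀ {v} → ¬ (v ∈ map (shift (2 * k)) (g p) × v ∈ blocksFrom g (suc k) ps)
  disjoint {v} (here-block , later) with ℕP.+-cancelˡ-≤ (2 * k) 2 1
    (ℕP.≤-trans (subst (_≤ col v) (next-block k) (blocksFrom-columns g (suc k) ps later))
                (block-columns g local (2 * k) p a here-block))
  ... | s≤s ()

blocksFrom-⊆ : ∀ g h → (∀ p → Admissible p → g p ⊆ h p) → ∀ k ps → All Admissible ps →
  blocksFrom g k ps ⊆ blocksFrom h k ps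
blocksFrom-⊆ g h sub k (p ∷ ps) (a ∷ as) m with ∈-++⁻ (map (shift (2 * k)) (g p)) m
... | inj₁ m₁ with ∈-map⁻ (shift (2 * k)) m₁
...   | w , w∈ , refl = ∈-++⁺ˡ (∈-map⁺ (shift (2 * k)) (sub p a w∈))
blocksFrom-⊆ g h sub k (p ∷ ps) (a ∷ as) m | inj₂ m₁ =
  ∈-++⁺ʳ (map (shift (2 * k)) (h p)) (blocksFrom-⊆ g h sub (suc k) ps as m₁)

inBlock-shift : ∀ k w → col w ≤ 1 → InBlock k (shift (2 * k) w)
inBlock-shift k (a , b) a≤1 with ℕP.n≤1⇒n≡0∨n≡1 a≤1
... | inj₁ refl = inj₁ (ℕP.+-identityʳ (2 * k))
... | inj₂ refl = inj₂ refl

shift-twoEnds : ∀ c {a mid b} → map (shift c) (a ∷ (mid ∷ʳ b)) ≡ shift c a ∷ (map (shift c) mid ∷ʳ shift c b)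
shift-twoEnds c {a} {mid} {b} = cong (shift c a ∷_) (map-++ (shift c) mid (b ∷ []))

blocksFrom-ends : ∀ g → (∀ p → Admissible p → HasTwoEnds (g p)) → LocalColumns g →
  ∀ k p ps → All Admissible (p ∷ ps) →
  ∃[ a ] ∃[ mid ] ∃[ b ] ((blocksFrom g k (p ∷ ps) ≡ a ∷ (mid ∷ʳ b)) × InBlock k a × InBlock (k + length ps) b)
blocksFrom-ends g ends local k p [] (a ∷ []) with ends p a
... | x₀ , mid , x₁ , eq =
  shift (2 * k) x₀ , map (shift (2 * k)) mid , shift (2 * k) x₁ ,
  trans (++-identityʳ _) (trans (cong (map (shift (2 * k))) eq) (shift-twoEnds (2 * k))) ,
  inBlock-shift k x₀ (local p a (subst (x₀ ∈_) (sym eq) (here refl))) ,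
  subst (λ n → InBlock n (shift (2 * k) x₁)) (sym (ℕP.+-identityʳ k))
    (inBlock-shift k x₁ (local p a (subst (x₁ ∈_) (sym eq) (∈-++⁺ʳ (x₀ ∷ mid) (here refl)))))
blocksFrom-ends g ends local k p (p' ∷ ps) (a ∷ as) with ends p a | blocksFrom-ends g ends local (suc k) p' ps as
... | x₀ , mid , x₁ , eq | y₀ , mid₁ , y₁ , eq₁ , _ , in-last =
  shift (2 * k) x₀ , (map (shift (2 * k)) (mid ∷ʳ x₁) ++ y₀ ∷ mid₁) , y₁ ,
  trans (cong₂ _++_ (cong (map (shift (2 * k))) eq) eq₁)
        (cong (shift (2 * k) x₀ ∷_) (sym (++-assoc (map (shift (2 * k)) (mid ∷ʳ x₁)) (y₀ ∷ mid₁) (y₁ ∷ [])))) ,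
  inBlock-shift k x₀ (local p a (subst (x₀ ∈_) (sym eq) (here refl))) ,
  subst (λ n → InBlock n y₁) (sym (ℕP.+-suc k (length ps))) in-last

blockV-unique : ∀ p → Admissible p → Unique (blockV p)
blockV-unique _ adm00 =
  ((λ ()) ∷ (λ ()) ∷ (λ ()) ∷ (λ ()) ∷ (λ ()) ∷ []) ∷ ((λ ()) ∷ (λ ()) ∷ (λ ()) ∷ (λ ()) ∷ []) ∷
  ((λ ()) ∷ (λ ()) ∷ (λ ()) ∷ []) ∷ ((λ ()) ∷ (λ ()) ∷ []) ∷ ((λ ()) ∷ []) ∷ [] ∷ []
blockV-unique _ adm01 =
  ((λ ()) ∷ (λ ()) ∷ (λ ()) ∷ (λ ()) ∷ (λ ()) ∷ []) ∷ ((λ ()) ∷ (λ ()) ∷ (λ ()) ∷ (λ ()) ∷ []) ∷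
  ((λ ()) ∷ (λ ()) ∷ (λ ()) ∷ []) ∷ ((λ ()) ∷ (λ ()) ∷ []) ∷ ((λ ()) ∷ []) ∷ [] ∷ []
blockV-unique _ adm10 =
  ((λ ()) ∷ (λ ()) ∷ (λ ()) ∷ (λ ()) ∷ (λ ()) ∷ []) ∷ ((λ ()) ∷ (λ ()) ∷ (λ ()) ∷ (λ ()) ∷ []) ∷
  ((λ ()) ∷ (λ ()) ∷ (λ ()) ∷ []) ∷ ((λ ()) ∷ (λ ()) ∷ []) ∷ ((λ ()) ∷ []) ∷ [] ∷ []

blockV-columns : LocalColumns blockV
blockV-columns p a = All.lookup (columns p a)
  where
  columns : ∀ p → Admissible p → All (λ v → col v ≤ 1) (blockV p)
  columns _ adm00 = z≤n ∷ s≤s z≤n ∷ z≤n ∷ s≤s z≤n ∷ z≤n ∷ z≤n ∷ []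
  columns _ adm01 = z≤n ∷ s≤s z≤n ∷ z≤n ∷ s≤s z≤n ∷ s≤s z≤n ∷ s≤s z≤n ∷ []
  columns _ adm10 = z≤n ∷ s≤s z≤n ∷ z≤n ∷ s≤s z≤n ∷ z≤n ∷ z≤n ∷ []

-- The two side paths

data Side : Set where
  top bottom : Side

sideBand : Side → Band
sideBand top    = upper
sideBand bottom = lower

OnSide : Side → Point → Set
OnSide s (_ , r) = (r ≡ row (sideBand s) 0) ⊎ (r ≡ row (sideBand s) 1)

onSide-level : ∀ s c {ℓ} → Level ℓ → OnSide s (c , row (sideBand s) ℓ)
onSide-level s c level0 = inj₁ refl
onSide-level s c level1 = inj₂ refl

sidePath : Side → Pair → List Point
sidePath top    (false , false) = (0 , 0) ∷ (1 , 0) ∷ []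
sidePath top    (false , true)  = (0 , 1) ∷ (1 , 1) ∷ []
sidePath top    (true  , false) = (0 , 1) ∷ (0 , 0) ∷ (1 , 0) ∷ []
sidePath top    (true  , true)  = []
sidePath bottom (false , false) = (0 , 5) ∷ (1 , 5) ∷ []
sidePath bottom (false , true)  = (0 , 4) ∷ (1 , 4) ∷ []
sidePath bottom (true  , false) = (0 , 4) ∷ (0 , 5) ∷ (1 , 5) ∷ []
sidePath bottom (true  , true)  = []

sidePath-unique : ∀ s p → Admissible p → Unique (sidePath s p)
sidePath-unique top    _ adm00 = ((λ ()) ∷ []) ∷ [] ∷ []
sidePath-unique top    _ adm01 = ((λ ()) ∷ []) ∷ [] ∷ []
sidePath-unique top    _ adm10 = ((λ ()) ∷ (λ ()) ∷ []) ∷ ((λ ()) ∷ []) ∷ [] ∷ []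
sidePath-unique bottom _ adm00 = ((λ ()) ∷ []) ∷ [] ∷ []
sidePath-unique bottom _ adm01 = ((λ ()) ∷ []) ∷ [] ∷ []
sidePath-unique bottom _ adm10 = ((λ ()) ∷ (λ ()) ∷ []) ∷ ((λ ()) ∷ []) ∷ [] ∷ []

sidePath-twoEnds : ∀ s p → Admissible p → HasTwoEnds (sidePath s p)
sidePath-twoEnds top    _ adm00 = _ , [] , _ , refl
sidePath-twoEnds top    _ adm01 = _ , [] , _ , refl
sidePath-twoEnds top    _ adm10 = _ , _ ∷ [] , _ , refl
sidePath-twoEnds bottom _ adm00 = _ , [] , _ , refl
sidePath-twoEnds bottom _ adm01 = _ , [] , _ , refl
sidePath-twoEnds bottom _ adm10 = _ , _ ∷ [] , _ , refl

sidePath-⊆ : ∀ s p → Admissible p → sidePath s p ⊆ blockV p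
sidePath-⊆ top    _ adm00 (here refl)                 = here refl
sidePath-⊆ top    _ adm00 (there (here refl))         = there (here refl)
sidePath-⊆ top    _ adm01 (here refl)                 = here refl
sidePath-⊆ top    _ adm01 (there (here refl))         = there (here refl)
sidePath-⊆ top    _ adm10 (here refl)                 = there (there (there (there (here refl))))
sidePath-⊆ top    _ adm10 (there (here refl))         = here refl
sidePath-⊆ top    _ adm10 (there (there (here refl))) = there (here refl)
sidePath-⊆ bottom _ adm00 (here refl)                 = there (there (here refl))
sidePath-⊆ bottom _ adm00 (there (here refl))         = there (there (there (here refl)))
sidePath-⊆ bottom _ adm01 (here refl)                 = there (there (here refl))
sidePath-⊆ bottom _ adm01 (there (here refl))         = there (there (there (here refl)))
sidePath-⊆ bottom _ adm10 (here refl)                 = there (there (there (there (there (here refl)))))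
sidePath-⊆ bottom _ adm10 (there (here refl))         = there (there (here refl))
sidePath-⊆ bottom _ adm10 (there (there (here refl))) = there (there (there (here refl)))

sidePath-columns : ∀ s → LocalColumns (sidePath s)
sidePath-columns s p a m = blockV-columns p a (sidePath-⊆ s p a m)

pathEntry : ∀ s c p → Admissible p → head (map (shift c) (sidePath s p)) ≡ just (c + 0 , row (sideBand s) (bOf p))
pathEntry top    c _ adm00 = refl
pathEntry top    c _ adm01 = refl
pathEntry top    c _ adm10 = refl
pathEntry bottom c _ adm00 = refl
pathEntry bottom c _ adm01 = refl
pathEntry bottom c _ adm10 = refl

pathExit : ∀ s c p → Admissible p → last (map (shift c) (sidePath s p)) ≡ just (c + 1 , row (sideBand s) (aOf p))
pathExit top    c _ adm00 = refl
pathExit top    c _ adm01 = refl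
pathExit top    c _ adm10 = refl
pathExit bottom c _ adm00 = refl
pathExit bottom c _ adm01 = refl
pathExit bottom c _ adm10 = refl

AdjIn : List (Point × Point) → Point → Point → Set
AdjIn es p q = ((p , q) ∈ es) ⊎ ((q , p) ∈ es)

adjIn-⊆ : ∀ {es es'} → es ⊆ es' → ∀ {p q} → AdjIn es p q → AdjIn es' p q
adjIn-⊆ sub (inj₁ e) = inj₁ (sub e)
adjIn-⊆ sub (inj₂ e) = inj₂ (sub e)

sidePath-linked-locally : ∀ s c p → Admissible p → Linked (AdjIn (map (shiftE c) (blockE p))) (map (shift c) (sidePath s p))
sidePath-linked-locally top    c _ adm00 = inj₁ (here refl) ∷ [-]
sidePath-linked-locally top    c _ adm01 = inj₁ (here refl) ∷ [-]
sidePath-linked-locally top    c _ adm10 = inj₂ (there (here refl)) ∷ inj₁ (here refl) ∷ [-]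
sidePath-linked-locally bottom c _ adm00 = inj₁ (there (here refl)) ∷ [-]
sidePath-linked-locally bottom c _ adm01 = inj₁ (there (here refl)) ∷ [-]
sidePath-linked-locally bottom c _ adm10 = inj₂ (there (there (there (here refl)))) ∷ inj₁ (there (there (here refl))) ∷ [-]

sidePathFrom : Side → ℕ → List Pair → List Point
sidePathFrom s = blocksFrom (sidePath s)

wellFormed-admissible : ∀ {ps} → WellFormed ps → All Admissible ps
wellFormed-admissible (single a)    = a ∷ []
wellFormed-admissible (a ∷⟨ _ ⟩ wf) = a ∷ wellFormed-admissible wf

wellFormed-head : ∀ {p ps} → WellFormed (p ∷ ps) → Admissible p
wellFormed-head (single a)    = a
wellFormed-head (a ∷⟨ _ ⟩ _) = a

nextEntry : ∀ s k p ps → Admissible p →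
  head (sidePathFrom s (suc k) (p ∷ ps)) ≡ just (2 * k + 2 , row (sideBand s) (bOf p))
nextEntry s k p ps a =
  trans (head-++ _ _ (pathEntry s (2 * suc k) p a))
        (cong (λ c → just (c , row (sideBand s) (bOf p))) (trans (ℕP.+-identityʳ _) (next-block k)))

junction : ∀ s k p p' ps → Admissible p → Admissible p' →
  Consecutive (sidePathFrom s k (p ∷ p' ∷ ps)) (2 * k + 1 , row (sideBand s) (aOf p)) (2 * k + 2 , row (sideBand s) (bOf p'))
junction s k p p' ps a a' =
  consecutive-junction (map (shift (2 * k)) (sidePath s p)) (sidePathFrom s (suc k) (p' ∷ ps)) (pathExit s (2 * k) p a) (nextEntry s k p' ps a')

connection-∈ : ∀ s k p p' → ((2 * k + 1 , row (sideBand s) (aOf p)) , (2 * k + 2 , row (sideBand s) (bOf p'))) ∈ connect k p p'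
connection-∈ top    k p p' = here refl
connection-∈ bottom k p p' = there (here refl)

sidePath-linked : ∀ s k ps → WellFormed ps → Linked (AdjIn (edgesFrom k ps)) (sidePathFrom s k ps)
sidePath-linked s k (p ∷ []) (single a) =
  subst (Linked _) (sym (++-identityʳ _)) (Linked.map (adjIn-⊆ (λ e → ∈-++⁺ˡ e)) (sidePath-linked-locally s (2 * k) p a))
sidePath-linked s k (p ∷ p' ∷ ps) (a ∷⟨ _ ⟩ wf) =
  linked-junction (map (shift (2 * k)) (sidePath s p)) (sidePathFrom s (suc k) (p' ∷ ps))
    (Linked.map (adjIn-⊆ (λ e → ∈-++⁺ˡ e)) (sidePath-linked-locally s (2 * k) p a))
    (Linked.map (adjIn-⊆ later) (sidePath-linked s (suc k) (p' ∷ ps) wf))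
    (pathExit s (2 * k) p a) (nextEntry s k p' ps (wellFormed-head wf))
    (inj₁ (∈-++⁺ʳ block (∈-++⁺ˡ (connection-∈ s k p p'))))
  where
  block = map (shiftE (2 * k)) (blockE p)
  later : edgesFrom (suc k) (p' ∷ ps) ⊆ edgesFrom k (p ∷ p' ∷ ps)
  later e = ∈-++⁺ʳ block (∈-++⁺ʳ (connect k p p') e)

data EdgeKind (k : ℕ) (ps : List Pair) : Point → Point → Set where
  sideEdge   : ∀ s {p q} → OnSide s p → OnSide s q → Neighbours (sidePathFrom s k ps) p q → EdgeKind k ps p q
  middleEdge : ∀ c → (c , 2) ∈ blocksFrom blockV k ps → (c , 3) ∈ blocksFrom blockV k ps → EdgeKind k ps (c , 2) (c , 3)

edgeKind-later : ∀ k p ps {v w} → EdgeKind (suc k) ps v w → EdgeKind k (p ∷ ps) v w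
edgeKind-later k p ps (sideEdge s v∈ w∈ n)  = sideEdge s v∈ w∈ (neighbours-++ˡ (map (shift (2 * k)) (sidePath s p)) n)
edgeKind-later k p ps (middleEdge c m₂ m₃) =
  middleEdge c (∈-++⁺ʳ (map (shift (2 * k)) (blockV p)) m₂) (∈-++⁺ʳ (map (shift (2 * k)) (blockV p)) m₃)

blockEdgeKind : ∀ k p ps → Admissible p → ∀ {v w} → (v , w) ∈ map (shiftE (2 * k)) (blockE p) → EdgeKind k (p ∷ ps) v w
blockEdgeKind k _ ps adm00 (here refl) = sideEdge top (inj₁ refl) (inj₁ refl) (inj₁ ([] , _ , refl))
blockEdgeKind k _ ps adm00 (there (here refl)) = sideEdge bottom (inj₁ refl) (inj₁ refl) (inj₁ ([] , _ , refl))
blockEdgeKind k _ ps adm00 (there (there (here refl))) =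
  middleEdge (2 * k + 0) (there (there (there (there (here refl))))) (there (there (there (there (there (here refl))))))
blockEdgeKind k _ ps adm01 (here refl) = sideEdge top (inj₂ refl) (inj₂ refl) (inj₁ ([] , _ , refl))
blockEdgeKind k _ ps adm01 (there (here refl)) = sideEdge bottom (inj₂ refl) (inj₂ refl) (inj₁ ([] , _ , refl))
blockEdgeKind k _ ps adm01 (there (there (here refl))) =
  middleEdge (2 * k + 1) (there (there (there (there (here refl))))) (there (there (there (there (there (here refl))))))
blockEdgeKind k _ ps adm10 (here refl) = sideEdge top (inj₁ refl) (inj₁ refl) (inj₁ (_ ∷ [] , _ , refl))
blockEdgeKind k _ ps adm10 (there (here refl)) = sideEdge top (inj₁ refl) (inj₂ refl) (inj₂ ([] , _ , refl))
blockEdgeKind k _ ps adm10 (there (there (here refl))) = sideEdge bottom (inj₁ refl) (inj₁ refl) (inj₁ (_ ∷ [] , _ , refl))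
blockEdgeKind k _ ps adm10 (there (there (there (here refl)))) = sideEdge bottom (inj₁ refl) (inj₂ refl) (inj₂ ([] , _ , refl))

edgeKind : ∀ k ps → WellFormed ps → ∀ {v w} → (v , w) ∈ edgesFrom k ps → EdgeKind k ps v w
edgeKind k (p ∷ ps) wf m with ∈-++⁻ (map (shiftE (2 * k)) (blockE p)) m
... | inj₁ m₁ = blockEdgeKind k p ps (wellFormed-head wf) m₁
edgeKind k (p ∷ []) wf m | inj₂ ()
edgeKind k (p ∷ p' ∷ ps) (a ∷⟨ _ ⟩ wf) m | inj₂ m₁ with ∈-++⁻ (connect k p p') m₁
... | inj₁ (here refl) =
  sideEdge top (onSide-level top (2 * k + 1) (aLevel p)) (onSide-level top (2 * k + 2) (bLevel p')) (inj₁ (junction top k p p' ps a (wellFormed-head wf)))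
... | inj₁ (there (here refl)) =
  sideEdge bottom (onSide-level bottom (2 * k + 1) (aLevel p)) (onSide-level bottom (2 * k + 2) (bLevel p')) (inj₁ (junction bottom k p p' ps a (wellFormed-head wf)))
... | inj₂ m₂ = edgeKind-later k p (p' ∷ ps) (edgeKind (suc k) (p' ∷ ps) wf m₂)

data VertexKind (k : ℕ) (ps : List Pair) : Point → Set where
  pathVertex   : ∀ s {v} → OnSide s v → v ∈ sidePathFrom s k ps → VertexKind k ps v
  middleVertex : ∀ c {v} → (v ≡ (c , 2)) ⊎ (v ≡ (c , 3)) → ((c , 2) , (c , 3)) ∈ edgesFrom k ps → VertexKind k ps v

blockVertexKind : ∀ k p ps → Admissible p → ∀ {v} → v ∈ map (shift (2 * k)) (blockV p) → VertexKind k (p ∷ ps) v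
blockVertexKind k _ ps adm00 (here refl) = pathVertex top (inj₁ refl) (here refl)
blockVertexKind k _ ps adm00 (there (here refl)) = pathVertex top (inj₁ refl) (there (here refl))
blockVertexKind k _ ps adm00 (there (there (here refl))) = pathVertex bottom (inj₁ refl) (here refl)
blockVertexKind k _ ps adm00 (there (there (there (here refl)))) = pathVertex bottom (inj₁ refl) (there (here refl))
blockVertexKind k _ ps adm00 (there (there (there (there (here refl))))) = middleVertex _ (inj₁ refl) (there (there (here refl)))
blockVertexKind k _ ps adm00 (there (there (there (there (there (here refl)))))) = middleVertex _ (inj₂ refl) (there (there (here refl)))
blockVertexKind k _ ps adm01 (here refl) = pathVertex top (inj₂ refl) (here refl)
blockVertexKind k _ ps adm01 (there (here refl)) = pathVertex top (inj₂ refl) (there (here refl))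
blockVertexKind k _ ps adm01 (there (there (here refl))) = pathVertex bottom (inj₂ refl) (here refl)
blockVertexKind k _ ps adm01 (there (there (there (here refl)))) = pathVertex bottom (inj₂ refl) (there (here refl))
blockVertexKind k _ ps adm01 (there (there (there (there (here refl))))) = middleVertex _ (inj₁ refl) (there (there (here refl)))
blockVertexKind k _ ps adm01 (there (there (there (there (there (here refl)))))) = middleVertex _ (inj₂ refl) (there (there (here refl)))
blockVertexKind k _ ps adm10 (here refl) = pathVertex top (inj₁ refl) (there (here refl))
blockVertexKind k _ ps adm10 (there (here refl)) = pathVertex top (inj₁ refl) (there (there (here refl)))
blockVertexKind k _ ps adm10 (there (there (here refl))) = pathVertex bottom (inj₁ refl) (there (here refl))
blockVertexKind k _ ps adm10 (there (there (there (here refl)))) = pathVertex bottom (inj₁ refl) (there (there (here refl)))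
blockVertexKind k _ ps adm10 (there (there (there (there (here refl))))) = pathVertex top (inj₂ refl) (here refl)
blockVertexKind k _ ps adm10 (there (there (there (there (there (here refl)))))) = pathVertex bottom (inj₂ refl) (here refl)

vertexKind : ∀ k ps → WellFormed ps → ∀ {v} → v ∈ blocksFrom blockV k ps → VertexKind k ps v
vertexKind k (p ∷ ps) wf m with ∈-++⁻ (map (shift (2 * k)) (blockV p)) m
... | inj₁ m₁ = blockVertexKind k p ps (wellFormed-head wf) m₁
vertexKind k (p ∷ []) wf m | inj₂ ()
vertexKind k (p ∷ p' ∷ ps) (_ ∷⟨ _ ⟩ wf) m | inj₂ m₁ with vertexKind (suc k) (p' ∷ ps) wf m₁
... | pathVertex s on m₂     = pathVertex s on (∈-++⁺ʳ (map (shift (2 * k)) (sidePath s p)) m₂)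
... | middleVertex c on m₂   =
  middleVertex c on (∈-++⁺ʳ (map (shiftE (2 * k)) (blockE p)) (∈-++⁺ʳ (connect k p p') m₂))

-- Graphs covered by vertex-disjoint paths

adj-sym : ∀ {G p q} → Adj G p q → Adj G q p
adj-sym (inj₁ e) = inj₂ e
adj-sym (inj₂ e) = inj₁ e

reach-trans : ∀ {G u v w} → Reach G u v → Reach G v w → Reach G u w
reach-trans here       r = r
reach-trans (step a q) r = step a (reach-trans q r)

linked-reach : ∀ {G L a b} → Linked (Adj G) L → a ∈ L → b ∈ L → Reach G a b
linked-reach [-]     (here refl) (here refl) = here
linked-reach (_ ∷ _) (here refl) (here refl) = here
linked-reach (r ∷ l) (here refl) (there b∈) = step r (linked-reach l (here refl) b∈)
linked-reach {G} (r ∷ l) (there a∈) (here refl) = reach-trans (linked-reach l a∈ (here refl)) (step (adj-sym {G} r) here)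
linked-reach (r ∷ l) (there a∈) (there b∈) = linked-reach l a∈ b∈

_≟ₚ_ : (p q : Point) → Dec (p ≡ q)
_≟ₚ_ = ≡-dec ℕ._≟_ ℕ._≟_

parity : List Point → Point → Bool
parity []      y = false
parity (x ∷ L) y with x ≟ₚ y
... | yes _ = false
... | no  _ = not (parity L y)

parity-here : ∀ y L → parity (y ∷ L) y ≡ false
parity-here y L with y ≟ₚ y
... | yes _  = refl
... | no y≢y = ⊥-elim (y≢y refl)

parity-there : ∀ x y L → x ≢ y → parity (x ∷ L) y ≡ not (parity L y)
parity-there x y L x≢y with x ≟ₚ y
... | yes x≡y = ⊥-elim (x≢y x≡y)
... | no  _   = refl

all-≢ : ∀ {x y : Point} {L} → All (x ≢_) L → y ∈ L → x ≢ y
all-≢ (x≢ ∷ _)  (here refl) = x≢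
all-≢ (_ ∷ x≢s) (there y∈)  = all-≢ x≢s y∈

parity-consecutive : ∀ xs {y z ys} → Unique (xs ++ y ∷ z ∷ ys) →
  parity (xs ++ y ∷ z ∷ ys) z ≡ not (parity (xs ++ y ∷ z ∷ ys) y)
parity-consecutive [] {y} {z} {ys} ((y≢z ∷ _) ∷ _)
  rewrite parity-there y z (z ∷ ys) y≢z | parity-here z ys | parity-here y (z ∷ ys) = refl
parity-consecutive (x ∷ xs) {y} {z} {ys} (x≢ ∷ unique)
  rewrite parity-there x z (xs ++ y ∷ z ∷ ys) (all-≢ x≢ (∈-++⁺ʳ xs (there (here refl))))
        | parity-there x y (xs ++ y ∷ z ∷ ys) (all-≢ x≢ (∈-++⁺ʳ xs (here refl)))
        | parity-consecutive xs unique = refl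

b≢not-b : ∀ b → b ≢ not b
b≢not-b true  ()
b≢not-b false ()

module PathCover (G : Graph) (component : Point → List Point)
  (edge-neighbours : ∀ p q → (p , q) ∈ E G → Neighbours (component p) p q × component q ≡ component p) where

  reach-within : ∀ {u w} → Reach G u w → u ∈ component u → w ∈ component u × component w ≡ component u
  reach-within here u∈ = u∈ , refl
  reach-within {u} (step {v = v} (inj₁ e) r) u∈ with edge-neighbours u v e
  ... | n , same with reach-within r (subst (v ∈_) (sym same) (proj₂ (neighbours-∈ n)))
  ...   | w∈ , same' = subst (_ ∈_) same w∈ , trans same' same
  reach-within {u} (step {v = v} (inj₂ e) r) u∈ with edge-neighbours v u e
  ... | n , same with reach-within r (proj₁ (neighbours-∈ n))
  ...   | w∈ , same' = subst (_ ∈_) (sym same) w∈ , trans same' (sym same)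

  componentIsPath : ∀ v (Shape : Point → Point → List Point → Set) →
    v ∈ component v → Unique (component v) → Linked (Adj G) (component v) →
    (∃[ a ] ∃[ mid ] ∃[ b ] ((component v ≡ a ∷ (mid ∷ʳ b)) × Shape a b mid)) →
    ComponentIsPath G v Shape
  componentIsPath v Shape v∈ unique linked (a , mid , b , eq , shape) =
    a , b , mid , subst Unique eq unique ,
    (λ w → mk⇔ (λ r → subst (w ∈_) eq (proj₁ (reach-within r v∈)))
                (λ w∈ → linked-reach linked v∈ (subst (w ∈_) (sym eq) w∈))) ,
    (λ xs y z ys e → linked-consecutive xs (subst (Linked (Adj G)) (trans eq e) linked)) ,
    (λ p q e r → as-split (subst (λ L → Neighbours L p q) (trans (proj₂ (reach-within r v∈)) eq)
                                 (proj₁ (edge-neighbours p q e)))) ,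
    shape
    where
    as-split : ∀ {L p q} → Neighbours L p q → ∃[ xs ] ∃[ ys ] ((L ≡ xs ++ p ∷ q ∷ ys) ⊎ (L ≡ xs ++ q ∷ p ∷ ys))
    as-split (inj₁ (xs , ys , e)) = xs , ys , inj₁ e
    as-split (inj₂ (xs , ys , e)) = xs , ys , inj₂ e

  bipartite : (∀ p → Unique (component p)) → Bipartite G
  bipartite unique = (λ p → parity (component p) p) , proper
    where
    proper : ∀ p q → (p , q) ∈ E G → parity (component p) p ≢ parity (component q) q
    proper p q e same-colour with edge-neighbours p q e
    ... | inj₁ (xs , ys , split) , same =
      b≢not-b (parity (component p) p)
        (trans same-colour (trans (cong (λ L → parity L q) same)
          (trans (cong (λ L → parity L q) split)
            (trans (parity-consecutive xs (subst Unique split (unique p)))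
                   (cong (λ L → not (parity L p)) (sym split))))))
    ... | inj₂ (xs , ys , split) , same =
      b≢not-b (parity (component p) p)
        (trans (cong (λ L → parity L p) split)
          (trans (parity-consecutive xs (subst Unique split (unique p)))
            (trans (cong (λ L → not (parity L q)) (sym split))
              (cong not (trans (cong (λ L → parity L q) (sym same)) (sym same-colour))))))

EdgeOrSpanning : List Pair → Point → Point → List Point → Set
EdgeOrSpanning ps a b mid = (mid ≡ []) ⊎ (InBlock 0 a × InBlock (length ps ∸ 1) b)

sidePath-spans : ∀ s ps → WellFormed ps →
  ∃[ a ] ∃[ mid ] ∃[ b ] ((sidePathFrom s 0 ps ≡ a ∷ (mid ∷ʳ b)) × EdgeOrSpanning ps a b mid)
sidePath-spans s (p ∷ ps) wf
  with blocksFrom-ends (sidePath s) (sidePath-twoEnds s) (sidePath-columns s) 0 p ps (wellFormed-admissible wf)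
... | a , mid , b , eq , in-first , in-last = a , mid , b , eq , inj₂ (in-first , in-last)

module Construction (ps : List Pair) (wf : WellFormed ps) where

  G : Graph
  G = mkGraph (blocksFrom blockV 0 ps) (blockEs (enum 0 ps) ++ connectEsFrom 0 ps)

  admissible : All Admissible ps
  admissible = wellFormed-admissible wf

  E⊆edgesFrom : E G ⊆ edgesFrom 0 ps
  E⊆edgesFrom = ∈-resp-↭ (edgesFrom-↭ 0 ps)

  edgesFrom⊆E : edgesFrom 0 ps ⊆ E G
  edgesFrom⊆E = ∈-resp-↭ (↭-sym (edgesFrom-↭ 0 ps))

  -- the ordered component of a vertex, read off from its row
  component : Point → List Point
  component (a , 0)                         = sidePathFrom top 0 ps
  component (a , 1)                         = sidePathFrom top 0 ps
  component (a , 2)                         = (a , 2) ∷ (a , 3) ∷ []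
  component (a , 3)                         = (a , 2) ∷ (a , 3) ∷ []
  component (a , suc (suc (suc (suc _)))) = sidePathFrom bottom 0 ps

  component-onSide : ∀ s v → OnSide s v → component v ≡ sidePathFrom s 0 ps
  component-onSide top    (a , .0) (inj₁ refl) = refl
  component-onSide top    (a , .1) (inj₂ refl) = refl
  component-onSide bottom (a , .5) (inj₁ refl) = refl
  component-onSide bottom (a , .4) (inj₂ refl) = refl

  edge-neighbours : ∀ p q → (p , q) ∈ E G → Neighbours (component p) p q × component q ≡ component p
  edge-neighbours p q e with edgeKind 0 ps wf (E⊆edgesFrom e)
  ... | sideEdge s p-on q-on n rewrite component-onSide s p p-on | component-onSide s q q-on = n , refl
  ... | middleEdge c _ _ = inj₁ ([] , [] , refl) , refl

  middle-unique : ∀ (a : ℕ) → Unique ((a , 2) ∷ (a , 3) ∷ [])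
  middle-unique a = ((λ ()) ∷ []) ∷ [] ∷ []

  sidePath-unique-from : ∀ s → Unique (sidePathFrom s 0 ps)
  sidePath-unique-from s = blocksFrom-unique (sidePath s) (sidePath-unique s) (sidePath-columns s) 0 ps admissible

  component-unique : ∀ v → Unique (component v)
  component-unique (a , 0)                         = sidePath-unique-from top
  component-unique (a , 1)                         = sidePath-unique-from top
  component-unique (a , 2)                         = middle-unique a
  component-unique (a , 3)                         = middle-unique a
  component-unique (a , suc (suc (suc (suc _)))) = sidePath-unique-from bottom

  open PathCover G component edge-neighbours

  graph-bipartite : Bipartite G
  graph-bipartite = bipartite component-unique

  components : ∀ v → v ∈ V G → ComponentIsPath G v (EdgeOrSpanning ps)
  components v v∈ with vertexKind 0 ps wf v∈
  ... | pathVertex s on m =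
    componentIsPath v (EdgeOrSpanning ps) (subst (v ∈_) (sym (component-onSide s v on)) m) (component-unique v)
      (subst (Linked (Adj G)) (sym (component-onSide s v on)) (Linked.map (adjIn-⊆ edgesFrom⊆E) (sidePath-linked s 0 ps wf)))
      (let (a , mid , b , eq , shape) = sidePath-spans s ps wf in a , mid , b , trans (component-onSide s v on) eq , shape)
  ... | middleVertex c (inj₁ refl) e =
    componentIsPath (c , 2) (EdgeOrSpanning ps) (here refl) (middle-unique c) (inj₁ (edgesFrom⊆E e) ∷ [-])
      ((c , 2) , [] , (c , 3) , refl , inj₁ refl)
  ... | middleVertex c (inj₂ refl) e =
    componentIsPath (c , 3) (EdgeOrSpanning ps) (there (here refl)) (middle-unique c) (inj₁ (edgesFrom⊆E e) ∷ [-])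
      ((c , 2) , [] , (c , 3) , refl , inj₁ refl)

  shape-of : ∀ {e} → e ∈ E G → Shaped e
  shape-of e = edgeShaped 0 ps wf (E⊆edgesFrom e)

  endpoints : ∀ p q → (p , q) ∈ E G → p ∈ V G × q ∈ V G
  endpoints p q e with edgeKind 0 ps wf (E⊆edgesFrom e)
  ... | sideEdge s _ _ n = let (p∈ , q∈) = neighbours-∈ n in on-path s p∈ , on-path s q∈
    where
    on-path : ∀ s → sidePathFrom s 0 ps ⊆ V G
    on-path s = blocksFrom-⊆ (sidePath s) blockV (sidePath-⊆ s) 0 ps admissible
  ... | middleEdge c m₂ m₃ = m₂ , m₃

  gridLayeredPlanar : IsGridLayeredPlanar G
  gridLayeredPlanar =
    blocksFrom-unique blockV blockV-unique blockV-columns 0 ps admissible ,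
    (λ p q e → let (p∈ , q∈) = endpoints p q e in p∈ , q∈ , distinct p q e) ,
    columns , crossings , vertices
    where
    distinct : ∀ p q → (p , q) ∈ E G → p ≢ q
    distinct p q e with shape-of e
    ... | s , c , refl = segment-distinct s c
    columns : ∀ p q → (p , q) ∈ E G → (col p ≤ suc (col q)) × (col q ≤ suc (col p))
    columns p q e with shape-of e
    ... | s , c , refl = segment-columns s c
    crossings : ∀ p q r s → (p , q) ∈ E G → (r , s) ∈ E G → ¬ SameEdge (p , q) (r , s) →
      ∀ d t u → 0 < d → t ≤ d → u ≤ d → SegMeet d t u p q r s → IsEndParam d t × IsEndParam d u
    crossings p q r s e₁ e₂ with shape-of e₁ | shape-of e₂
    ... | s₁ , c₁ , refl | s₂ , c₂ , refl = segments-meet-at-ends s₁ c₁ s₂ c₂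
    vertices : ∀ v p q → v ∈ V G → (p , q) ∈ E G →
      ∀ d t → 0 < d → t ≤ d → SegMeet d t 0 p q v v → IsEndParam d t
    vertices v p q _ e with shape-of e
    ... | s , c , refl = vertex-at-end s c v

lemma4 : (x : List Bool) →
    Bipartite (Gx x) × IsGridLayeredPlanar (Gx x)
    × (∀ v → v ∈ V (Gx x) →
         ComponentIsPath (Gx x) v
           (λ a b mid → (mid ≡ []) ⊎ (InBlock 0 a × InBlock (numBlocks x ∸ 1) b)))
lemma4 x = graph-bipartite , gridLayeredPlanar , components
  where open Construction (P x) (P-wellFormed x)
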